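{- Let $k\ge 1$ and let $G$ be a graph such that the near-$k$-twin relation $\rho_k$ of $G$ is an equivalence relation on $V(G)$. Let $U$ and $V$ be two equivalence classes of $\rho_k$ (possibly $U=V$) with $|U|,|V|\ge 5k+1$. Then exactly one of the following holds: (a) every vertex of $U$ is adjacent to at most $2k$ vertices of $V$ and every vertex of $V$ is adjacent to at most $2k$ vertices of $U$; or (b) every vertex of $U$ is adjacent to all but at most $2k$ vertices of $V$ and every vertex of $V$ is adjacent to all but at most $2k$ vertices of $U$.
   Context: Graphs are finite, simple and undirected. $N(v)=\{w\mid\{v,w\}\in E(G)\}$ (so $v\notin N(v)$), and $\mathop{\bigtriangleup}$ is symmetric difference. The near-$k$-twin relation $\rho_k$ of $G$ is the relation on $V(G)$ with $(u,v)\in\rho_k$ iff $|N(u)\mathop{\bigtriangleup} N(v)|\le k$. -}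

module Defs where

open import Data.Nat using (ℕ; zero; suc; _+_; _≤_; _≤?_)
open import Data.Bool using (Bool; true; false; not; _xor_; _∧_; if_then_else_)
open import Data.Fin using (Fin)
open import Data.List using (List; map)
open import Data.Nat.ListAction using (sum)
open import Data.Fin.Base using ()
open import Data.List.Base using ()
open import Data.Product using (_×_)
open import Relation.Nullary.Decidable using (⌊_⌋)
open import Relation.Binary.PropositionalEquality using (_≡_)
import Data.List as L
import Data.Fin as F

record Graph (n : ℕ) : Set where
  field
    adj   : Fin n → Fin n → Bool
    sym   : ∀ u v → adj u v ≡ adj v u
    irrefl : ∀ v → adj v v ≡ false
open Graph public

count : {n : ℕ} → (Fin n → Bool) → ℕ
count {n} P = sum (map (λ w → if P w then 1 else 0) (L.allFin n))

symDiffSize : {n : ℕ} → Graph n → Fin n → Fin n → ℕ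
symDiffSize G u v = count (λ w → adj G u w xor adj G v w)

ρ : {n : ℕ} → Graph n → ℕ → Fin n → Fin n → Set
ρ G k u v = symDiffSize G u v ≤ k

inClass : {n : ℕ} → Graph n → ℕ → Fin n → Fin n → Bool
inClass G k u v = ⌊ symDiffSize G u v ≤? k ⌋

classSize : {n : ℕ} → Graph n → ℕ → Fin n → ℕ
classSize G k u = count (inClass G k u)

nbrsIn : {n : ℕ} → Graph n → ℕ → Fin n → Fin n → ℕ
nbrsIn G k c x = count (λ w → inClass G k c w ∧ adj G x w)

nonNbrsIn : {n : ℕ} → Graph n → ℕ → Fin n → Fin n → ℕ
nonNbrsIn G k c x = count (λ w → inClass G k c w ∧ not (adj G x w))

-- Fix classes U ∋ c and V ∋ d and a
-- polarity b (adjacent or non-adjacent). If some x ∈ U has more than 2k b-neighbours in V, double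
-- counting shows that d has at most 2k non-b-neighbours in U, since W O ≤ (W + O) k forces
-- W ≤ 2k or O ≤ 2k. As |U| ≥ 5k + 1, every x ∈ U has at most 2k b-neighbours in V for b = true
-- or for b = false, and because near-twins x, x' change these counts by at most k (and |V| ≥ 5k + 1),
-- the same b serves all of U. A second double count of the U–V edges shows that the polarities
-- chosen for (U, V) and (V, U) agree, and |V| ≥ 5k + 1 makes the two alternatives exclusive.

module Submission where

open import Defs
open import Data.Nat using (ℕ; zero; suc; _≤_; _<_; _*_; _+_; z≤n; _≤?_)
open import Data.Nat.Properties
  using (≤-refl; ≤-trans; ≤-reflexive; ≤-total; ≤⇒≯; ≰⇒>; +-mono-≤; +-monoˡ-≤; +-monoʳ-≤; m≤m+n;
         +-comm; *-comm; *-monoˡ-≤; *-cancelˡ-≤; module ≤-Reasoning)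
open import Data.Nat.Tactic.RingSolver using (solve-∀)
open import Data.Nat.ListAction using (sum)
open import Data.Bool using (Bool; true; false; not; T; _xor_; _∧_; if_then_else_)
open import Data.Bool.Properties using (T-∧; not-involutive)
open import Data.Fin using (Fin)
open import Data.List using (List; []; _∷_; map; allFin)
open import Data.Product using (_×_; _,_; proj₁; proj₂)
open import Data.Sum using (_⊎_; inj₁; inj₂; [_,_]′)
open import Data.Unit using (tt)
open import Data.Empty using (⊥; ⊥-elim)
open import Function.Base using (_∘_; id)
open import Function.Bundles using (Equivalence)
open import Relation.Nullary using (¬_; yes; no)
open import Relation.Nullary.Decidable using (toWitness)
open import Relation.Binary.Structures using (IsEquivalence)
open import Relation.Binary.PropositionalEquality
  using (_≡_; refl; cong; cong₂; subst; subst₂; module ≡-Reasoning)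
  renaming (sym to ≡-sym)

∑ : {A : Set} → List A → (A → ℕ) → ℕ
∑ xs f = sum (map f xs)

module _ {A : Set} where

  ∑-mono : (xs : List A) {f g : A → ℕ} → (∀ a → f a ≤ g a) → ∑ xs f ≤ ∑ xs g
  ∑-mono []       f≤g = z≤n
  ∑-mono (x ∷ xs) f≤g = +-mono-≤ (f≤g x) (∑-mono xs f≤g)

  ∑-+ : (xs : List A) (f g : A → ℕ) → ∑ xs (λ a → f a + g a) ≡ ∑ xs f + ∑ xs g
  ∑-+ []       f g = refl
  ∑-+ (x ∷ xs) f g = begin
    (f x + g x) + ∑ xs (λ a → f a + g a) ≡⟨ cong ((f x + g x) +_) (∑-+ xs f g) ⟩
    (f x + g x) + (∑ xs f + ∑ xs g)      ≡⟨ interchange (f x) (g x) (∑ xs f) (∑ xs g) ⟩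
    (f x + ∑ xs f) + (g x + ∑ xs g)      ∎
    where
    open ≡-Reasoning
    interchange : ∀ a b c d → (a + b) + (c + d) ≡ (a + c) + (b + d)
    interchange = solve-∀

  ∑-zero : (xs : List A) → ∑ xs (λ _ → 0) ≡ 0
  ∑-zero []       = refl
  ∑-zero (x ∷ xs) = ∑-zero xs

  ∑-if : (xs : List A) (P : A → Bool) (c : ℕ) →
         ∑ xs (λ a → if P a then c else 0) ≡ ∑ xs (λ a → if P a then 1 else 0) * c
  ∑-if []       P c = refl
  ∑-if (x ∷ xs) P c with P x
  ... | true  = cong (c +_) (∑-if xs P c)
  ... | false = ∑-if xs P c

∑-swap : {A B : Set} (xs : List A) (ys : List B) (f : A → B → ℕ) →
         ∑ xs (λ a → ∑ ys (f a)) ≡ ∑ ys (λ b → ∑ xs (λ a → f a b))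
∑-swap []       ys f = ≡-sym (∑-zero ys)
∑-swap (x ∷ xs) ys f = begin
  ∑ ys (f x) + ∑ xs (λ a → ∑ ys (f a))          ≡⟨ cong (∑ ys (f x) +_) (∑-swap xs ys f) ⟩
  ∑ ys (f x) + ∑ ys (λ b → ∑ xs (λ a → f a b))  ≡⟨ ∑-+ ys (f x) (λ b → ∑ xs (λ a → f a b)) ⟨
  ∑ ys (λ b → f x b + ∑ xs (λ a → f a b))       ∎
  where open ≡-Reasoning

∧-intro : ∀ {p q} → T p × T q → T (p ∧ q)
∧-intro = Equivalence.from T-∧

∧-elim : ∀ {p q} → T (p ∧ q) → T p × T q
∧-elim = Equivalence.to T-∧

indicator-mono : ∀ {p q} → (T p → T q) → (if p then 1 else 0) ≤ (if q then 1 else 0)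
indicator-mono {false}         _   = z≤n
indicator-mono {true}  {true}  _   = ≤-refl
indicator-mono {true}  {false} p⇒q = ⊥-elim (p⇒q tt)

indicator-⊎ : ∀ {p q r} → (T p → T q ⊎ T r) →
              (if p then 1 else 0) ≤ (if q then 1 else 0) + (if r then 1 else 0)
indicator-⊎ {false}                 _ = z≤n
indicator-⊎ {true}  {true}          _ = m≤m+n 1 _
indicator-⊎ {true}  {false} {true}  _ = ≤-refl
indicator-⊎ {true}  {false} {false} p⇒q⊎r with p⇒q⊎r tt
... | inj₁ ()
... | inj₂ ()

module _ {n : ℕ} where

  count-mono : {P Q : Fin n → Bool} → (∀ w → T (P w) → T (Q w)) → count P ≤ count Q
  count-mono P⇒Q = ∑-mono (allFin n) (λ w → indicator-mono (P⇒Q w))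

  count-≤-+ : {P Q R : Fin n → Bool} → (∀ w → T (P w) → T (Q w) ⊎ T (R w)) →
              count P ≤ count Q + count R
  count-≤-+ {P} {Q} {R} P⇒Q⊎R = ≤-trans
    (∑-mono (allFin n) (λ w → indicator-⊎ (P⇒Q⊎R w)))
    (≤-reflexive (∑-+ (allFin n) (λ w → if Q w then 1 else 0) (λ w → if R w then 1 else 0)))

  count-∧ʳ : (P Q : Fin n → Bool) → count (λ w → P w ∧ Q w) ≤ count Q
  count-∧ʳ P Q = count-mono (λ w → proj₂ ∘ ∧-elim)

  double-count : (P Q : Fin n → Bool) (e : Fin n → Fin n → Bool) {a b : ℕ} →
    (∀ x → T (P x) → count Q ≤ count (λ y → Q y ∧ e x y) + a) →
    (∀ y → T (Q y) → count (λ x → P x ∧ e x y) ≤ b) →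
    count P * count Q ≤ count Q * b + count P * a
  double-count P Q e {a} {b} rows cols = begin
    count P * count Q                                ≡⟨ ∑-if Fn P (count Q) ⟨
    ∑ Fn (λ x → if P x then count Q else 0)          ≤⟨ ∑-mono Fn row ⟩
    ∑ Fn (λ x → ∑ Fn (edge x) + (if P x then a else 0))
      ≡⟨ ∑-+ Fn (λ x → ∑ Fn (edge x)) (λ x → if P x then a else 0) ⟩
    ∑ Fn (λ x → ∑ Fn (edge x)) + ∑ Fn (λ x → if P x then a else 0)
      ≡⟨ cong₂ _+_ (∑-swap Fn Fn edge) (∑-if Fn P a) ⟩
    ∑ Fn (λ y → ∑ Fn (λ x → edge x y)) + count P * a ≤⟨ +-monoˡ-≤ _ (∑-mono Fn col) ⟩
    ∑ Fn (λ y → if Q y then b else 0) + count P * a  ≡⟨ cong (_+ count P * a) (∑-if Fn Q b) ⟩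
    count Q * b + count P * a                        ∎
    where
    open ≤-Reasoning
    Fn = allFin n
    edge : Fin n → Fin n → ℕ
    edge x y = if P x ∧ (Q y ∧ e x y) then 1 else 0
    -- edge is unfolded in these types so that with can abstract P x and Q y
    row : ∀ x → (if P x then count Q else 0) ≤
                ∑ Fn (λ y → if P x ∧ (Q y ∧ e x y) then 1 else 0) + (if P x then a else 0)
    row x with P x | rows x
    ... | true  | dense = dense tt
    ... | false | _     = z≤n
    col : ∀ y → ∑ Fn (λ x → if P x ∧ (Q y ∧ e x y) then 1 else 0) ≤ (if Q y then b else 0)
    col y with Q y | cols y
    ... | true  | sparse = sparse tt
    ... | false | _      = ≤-trans (count-∧ʳ P (λ _ → false)) (≤-reflexive (∑-zero Fn))

smaller-factor-≤ : ∀ k {W O} → O ≤ W → W * O ≤ O * k + W * k → O ≤ 2 * k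
smaller-factor-≤ k {zero}  {zero} _   _   = z≤n
smaller-factor-≤ k {suc w} {O}    O≤W WO≤ = *-cancelˡ-≤ (suc w) (begin
  suc w * O             ≤⟨ WO≤ ⟩
  O * k + suc w * k     ≤⟨ +-monoˡ-≤ (suc w * k) (*-monoˡ-≤ k O≤W) ⟩
  suc w * k + suc w * k ≡⟨ double (suc w) k ⟩
  suc w * (2 * k)       ∎)
  where
  open ≤-Reasoning
  double : ∀ a b → a * b + a * b ≡ a * (2 * b)
  double = solve-∀

small-factor : ∀ k {W O} → W * O ≤ O * k + W * k → W ≤ 2 * k ⊎ O ≤ 2 * k
small-factor k {W} {O} WO≤ with ≤-total O W
... | inj₁ O≤W = inj₂ (smaller-factor-≤ k O≤W WO≤)
... | inj₂ W≤O = inj₁ (smaller-factor-≤ k W≤O (subst₂ _≤_ (*-comm W O) (+-comm (O * k) (W * k)) WO≤))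

one-side-small : ∀ {n} k (P Q : Fin n → Bool) (e : Fin n → Fin n → Bool) →
  (∀ x → T (P x) → count Q ≤ count (λ y → Q y ∧ e x y) + k) →
  (∀ y → T (Q y) → count (λ x → P x ∧ e x y) ≤ k) →
  count P ≤ 2 * k ⊎ count Q ≤ 2 * k
one-side-small k P Q e rows cols = small-factor k (double-count P Q e rows cols)

literal : Bool → Bool → Bool
literal b p = if b then p else not p

literal-split : ∀ b p → T (literal b p) ⊎ T (literal (not b) p)
literal-split true  true  = inj₁ tt
literal-split true  false = inj₂ tt
literal-split false true  = inj₂ tt
literal-split false false = inj₁ tt

literal-opposite : ∀ b p r → T (literal b p) → T (literal (not b) r) → T (p xor r)
literal-opposite true  true  false _ _ = tt
literal-opposite false false true  _ _ = tt

literal-shift : ∀ b p q → T (literal b q) → T (literal b p) ⊎ T (p xor q)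
literal-shift b     true  true  bq = inj₁ bq
literal-shift b     false false bq = inj₁ bq
literal-shift b     true  false _  = inj₂ tt
literal-shift b     false true  _  = inj₂ tt

xor-triangle : ∀ p q r → T (p xor r) → T (p xor q) ⊎ T (q xor r)
xor-triangle true  true  false _ = inj₂ tt
xor-triangle true  false false _ = inj₁ tt
xor-triangle false true  true  _ = inj₁ tt
xor-triangle false false true  _ = inj₂ tt

module NearTwinClasses {n : ℕ} (k : ℕ) (G : Graph n) (ρ-equiv : IsEquivalence (ρ G k)) where
  open IsEquivalence ρ-equiv renaming (refl to ρ-refl; sym to ρ-sym; trans to ρ-trans)

  link : Bool → Fin n → Fin n → Bool
  link b u w = literal b (adj G u w)

  -- linksIn true and linksIn false are nbrsIn and nonNbrsIn
  linksIn : Bool → Fin n → Fin n → ℕ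
  linksIn b c x = count (λ w → inClass G k c w ∧ link b x w)

  member : ∀ {c w} → T (inClass G k c w) → ρ G k c w
  member = toWitness

  exceeds-5k : ∀ {m} → 5 * k + 1 ≤ m → m ≤ 5 * k → ⊥
  exceeds-5k big small = ≤⇒≯ small (≤-trans (≤-reflexive (+-comm 1 (5 * k))) big)

  classSize-≤-linksIn : ∀ b c x → classSize G k c ≤ linksIn b c x + linksIn (not b) c x
  classSize-≤-linksIn b c x = count-≤-+ split
    where
    split : ∀ w → T (inClass G k c w) →
            T (inClass G k c w ∧ link b x w) ⊎ T (inClass G k c w ∧ link (not b) x w)
    split w cw with literal-split b (adj G x w)
    ... | inj₁ l = inj₁ (∧-intro (cw , l))
    ... | inj₂ l = inj₂ (∧-intro (cw , l))

  linksIn-shift : ∀ b d {x x'} → ρ G k x x' → linksIn b d x' ≤ linksIn b d x + k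
  linksIn-shift b d {x} {x'} xx' = ≤-trans (count-≤-+ shift) (+-monoʳ-≤ (linksIn b d x) xx')
    where
    shift : ∀ w → T (inClass G k d w ∧ link b x' w) →
            T (inClass G k d w ∧ link b x w) ⊎ T (adj G x w xor adj G x' w)
    shift w dw∧l with ∧-elim dw∧l
    ... | dw , l with literal-shift b (adj G x w) (adj G x' w) l
    ...   | inj₁ l' = inj₁ (∧-intro (dw , l'))
    ...   | inj₂ δ  = inj₂ δ

  -- Count pairs (x', y), x' ∈ U not b-linked to d, y ∈ V b-linked to x, with adj x' y ≠ adj d x'.
  -- Each y, a near-twin of d, lies in at most k of them; each x' in all but at most k, since
  -- x' and x disagree on at most k vertices.
  opposite-links-few : ∀ b {c d x} → ρ G k c x → 2 * k < linksIn b d x → linksIn (not b) c d ≤ 2 * k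
  opposite-links-few b {c} {d} {x} cx many =
    [ id , (λ fewer → ⊥-elim (≤⇒≯ fewer many)) ]′ (one-side-small k P Q edge rows cols)
    where
    P Q : Fin n → Bool
    P x' = inClass G k c x' ∧ link (not b) d x'
    Q y  = inClass G k d y ∧ link b x y
    edge : Fin n → Fin n → Bool
    edge x' y = adj G x' y xor adj G d x'
    rows : ∀ x' → T (P x') → count Q ≤ count (λ y → Q y ∧ edge x' y) + k
    rows x' Px' =
      ≤-trans (count-≤-+ differs) (+-monoʳ-≤ _ (ρ-trans (ρ-sym cx) (member (proj₁ (∧-elim Px')))))
      where
      differs : ∀ y → T (Q y) → T (Q y ∧ edge x' y) ⊎ T (adj G x y xor adj G x' y)
      differs y Qy with xor-triangle (adj G x y) (adj G x' y) (adj G d x')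
                          (literal-opposite b _ _ (proj₂ (∧-elim Qy)) (proj₂ (∧-elim Px')))
      ... | inj₁ δ = inj₂ δ
      ... | inj₂ δ = inj₁ (∧-intro (Qy , δ))
    cols : ∀ y → T (Q y) → count (λ x' → P x' ∧ edge x' y) ≤ k
    cols y Qy = ≤-trans (count-mono edge⇒δ) (ρ-sym (member (proj₁ (∧-elim Qy))))
      where
      edge⇒δ : ∀ x' → T (P x' ∧ edge x' y) → T (adj G y x' xor adj G d x')
      edge⇒δ x' P∧e = subst (λ t → T (t xor adj G d x')) (sym G x' y) (proj₂ (∧-elim P∧e))

  one-sided : ∀ b {c d x} → ρ G k c x → 5 * k + 1 ≤ classSize G k c →
              linksIn b d x ≤ 2 * k ⊎ linksIn (not b) d x ≤ 2 * k
  one-sided b {c} {d} {x} cx bigU with linksIn b d x ≤? 2 * k | linksIn (not b) d x ≤? 2 * k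
  ... | yes few | _       = inj₁ few
  ... | no _    | yes few = inj₂ few
  ... | no many | no many' = ⊥-elim (exceeds-5k bigU (begin
    classSize G k c                        ≤⟨ classSize-≤-linksIn b c d ⟩
    linksIn b c d + linksIn (not b) c d    ≤⟨ +-mono-≤ fewᵇ (opposite-links-few b cx (≰⇒> many)) ⟩
    2 * k + 2 * k                          ≤⟨ m≤m+n (2 * k + 2 * k) k ⟩
    2 * k + 2 * k + k                      ≡⟨ sum-5k k ⟩
    5 * k                                  ∎))
    where
    open ≤-Reasoning
    fewᵇ : linksIn b c d ≤ 2 * k
    fewᵇ = subst (λ b' → linksIn b' c d ≤ 2 * k) (not-involutive b)
                 (opposite-links-few (not b) cx (≰⇒> many'))
    sum-5k : ∀ k → 2 * k + 2 * k + k ≡ 5 * k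
    sum-5k = solve-∀

  mixed-impossible : ∀ b {c d x x'} → ρ G k c x → ρ G k c x' → 5 * k + 1 ≤ classSize G k d →
                     linksIn b d x ≤ 2 * k → linksIn (not b) d x' ≤ 2 * k → ⊥
  mixed-impossible b {d = d} {x} {x'} cx cx' bigV few few' = exceeds-5k bigV (begin
    classSize G k d                        ≤⟨ classSize-≤-linksIn b d x' ⟩
    linksIn b d x' + linksIn (not b) d x'  ≤⟨ +-monoˡ-≤ _ (linksIn-shift b d (ρ-trans (ρ-sym cx) cx')) ⟩
    linksIn b d x + k + linksIn (not b) d x' ≤⟨ +-mono-≤ (+-monoˡ-≤ k few) few' ⟩
    2 * k + k + 2 * k                      ≡⟨ sum-5k k ⟩
    5 * k                                  ∎)
    where
    open ≤-Reasoning
    sum-5k : ∀ k → 2 * k + k + 2 * k ≡ 5 * k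
    sum-5k = solve-∀

  Sided : Bool → Fin n → Fin n → Set
  Sided b c d = ∀ x → ρ G k c x → linksIn b d x ≤ 2 * k

  sided : ∀ {c d} → 5 * k + 1 ≤ classSize G k c → 5 * k + 1 ≤ classSize G k d →
          Sided true c d ⊎ Sided false c d
  sided {c} {d} bigU bigV =
    [ inj₁ ∘ spread true , inj₂ ∘ spread false ]′ (one-sided true {d = d} ρ-refl bigU)
    where
    spread : ∀ b → linksIn b d c ≤ 2 * k → Sided b c d
    spread b few x cx = [ id , (λ few' → ⊥-elim (mixed-impossible b ρ-refl cx bigV few few')) ]′
                          (one-sided b cx bigU)

  ¬-cross-sided : ∀ b {c d} → 5 * k + 1 ≤ classSize G k c → 5 * k + 1 ≤ classSize G k d →
                  Sided b c d → Sided (not b) d c → ⊥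
  ¬-cross-sided b {c} {d} bigU bigV sidedᶜ sidedᵈ =
    [ exceeds-5k bigV ∘ ≤5k , exceeds-5k bigU ∘ ≤5k ]′
      (one-side-small (2 * k) (inClass G k d) (inClass G k c) (link b) rows cols)
    where
    rows : ∀ y → T (inClass G k d y) → classSize G k c ≤ linksIn b c y + 2 * k
    rows y dy = ≤-trans (classSize-≤-linksIn b c y) (+-monoʳ-≤ _ (sidedᵈ y (member dy)))
    cols : ∀ x → T (inClass G k c x) → count (λ y → inClass G k d y ∧ link b y x) ≤ 2 * k
    cols x cx = ≤-trans (count-mono link-sym) (sidedᶜ x (member cx))
      where
      link-sym : ∀ y → T (inClass G k d y ∧ link b y x) → T (inClass G k d y ∧ link b x y)
      link-sym y = subst (λ t → T (inClass G k d y ∧ literal b t)) (sym G y x)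
    ≤5k : ∀ {m} → m ≤ 2 * (2 * k) → m ≤ 5 * k
    ≤5k m≤4k = ≤-trans m≤4k (≤-trans (m≤m+n (2 * (2 * k)) k) (≤-reflexive (sum-5k k)))
      where
      sum-5k : ∀ k → 2 * (2 * k) + k ≡ 5 * k
      sum-5k = solve-∀

  sided-both : ∀ {c d} → 5 * k + 1 ≤ classSize G k c → 5 * k + 1 ≤ classSize G k d →
               (Sided true c d × Sided true d c) ⊎ (Sided false c d × Sided false d c)
  sided-both bigU bigV with sided bigU bigV | sided bigV bigU
  ... | inj₁ cd | inj₁ dc = inj₁ (cd , dc)
  ... | inj₂ cd | inj₂ dc = inj₂ (cd , dc)
  ... | inj₁ cd | inj₂ dc = ⊥-elim (¬-cross-sided true bigU bigV cd dc)
  ... | inj₂ cd | inj₁ dc = ⊥-elim (¬-cross-sided false bigU bigV cd dc)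

corollary9 : (k n : ℕ) → 1 ≤ k → (G : Graph n) →
  IsEquivalence (ρ G k) →
  (u₀ v₀ : Fin n) →
  5 * k + 1 ≤ classSize G k u₀ → 5 * k + 1 ≤ classSize G k v₀ →
  let A = ((∀ x → ρ G k u₀ x → nbrsIn G k v₀ x ≤ 2 * k) ×
           (∀ y → ρ G k v₀ y → nbrsIn G k u₀ y ≤ 2 * k))
      B = ((∀ x → ρ G k u₀ x → nonNbrsIn G k v₀ x ≤ 2 * k) ×
           (∀ y → ρ G k v₀ y → nonNbrsIn G k u₀ y ≤ 2 * k))
  in (A ⊎ B) × ¬ (A × B)
corollary9 k n _ G ρ-equiv u₀ v₀ bigU bigV =
  sided-both bigU bigV ,
  λ (A , B) → mixed-impossible true ρ-refl ρ-refl bigV (proj₁ A u₀ ρ-refl) (proj₁ B u₀ ρ-refl)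
  where
  open NearTwinClasses k G ρ-equiv
  open IsEquivalence ρ-equiv using () renaming (refl to ρ-refl)
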